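{- For $n\ge1$, $$\Bigl(\frac{1+x}{2}\Bigr)^n\sum_{\sigma\in\mathfrak S_{n+1}}\Bigl(\frac{4x}{(1+x)^2}\Bigr)^{{\rm M}(\sigma)}=\sum_{k=1}^n\binom nk(1-x)^{n-k}\sum_{\sigma\in\mathfrak S_k}x^{{\rm des}(\sigma)+1}2^{{\rm LRmin}(\sigma)}+(1-x)^n.$$
   Context: $\mathfrak S_m$ is the set of permutations $\sigma=\sigma_1\cdots\sigma_m$ of $[m]$. ${\rm M}(\sigma)$ = number of interior peaks ($1<i<m$, $\sigma_{i-1}<\sigma_i>\sigma_{i+1}$); ${\rm des}(\sigma)$ = number of $1\le i<m$ with $\sigma_i>\sigma_{i+1}$; ${\rm LRmin}(\sigma)$ = number of entries smaller than all entries to their left. The identity is one of rational functions in $x$. -}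

module Defs where

open import Data.Nat as ℕ using (ℕ; zero; suc; _<ᵇ_)
open import Data.Nat.Combinatorics using (_C_)
open import Data.Bool using (Bool; true; false; if_then_else_; _∧_)
open import Data.Fin using (Fin; toℕ; _≟_)
open import Data.List using (List; []; _∷_; map; concatMap; filter; foldr; upTo; allFin)
open import Data.Vec using (Vec; toList)
import Data.Vec as Vec
import Data.List.Relation.Unary.Unique.DecPropositional as UDP
open import Data.Integer using (+_)
open import Data.Rational using (ℚ; 0ℚ; 1ℚ; _+_; _*_; _-_; 1/_; ½; ≢-nonZero)
open import Relation.Binary.PropositionalEquality using (_≢_)

allVecs : (m k : ℕ) → List (Vec (Fin m) k)
allVecs m zero = Vec.[] ∷ []
allVecs m (suc k) = concatMap (λ i → map (i Vec.∷_) (allVecs m k)) (allFin m)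

-- 𝔖_m : the permutations of [m] in one-line notation, i.e. the injective
-- words σ₁⋯σ_m over {0,…,m-1} (values shifted by one; all statistics below
-- only compare values, so the shift is immaterial)
perms : ℕ → List (List ℕ)
perms m = map (λ v → map toℕ (toList v))
              (filter (λ v → UDP.unique? (_≟_ {m}) (toList v)) (allVecs m m))

des : List ℕ → ℕ
des (a ∷ b ∷ r) = (if b <ᵇ a then 1 else 0) ℕ.+ des (b ∷ r)
des _ = 0

peaks : List ℕ → ℕ
peaks (a ∷ b ∷ c ∷ r) = (if (a <ᵇ b) ∧ (c <ᵇ b) then 1 else 0) ℕ.+ peaks (b ∷ c ∷ r)
peaks _ = 0

lrminFrom : ℕ → List ℕ → ℕ
lrminFrom m [] = 0
lrminFrom m (a ∷ r) = if a <ᵇ m then suc (lrminFrom a r) else lrminFrom m r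

lrmin : List ℕ → ℕ
lrmin [] = 0
lrmin (a ∷ r) = suc (lrminFrom a r)

infixr 8 _^q_
_^q_ : ℚ → ℕ → ℚ
q ^q zero = 1ℚ
q ^q suc n = q * (q ^q n)

ofℕ : ℕ → ℚ
ofℕ n = + n Data.Rational./ 1

sumQ : List ℚ → ℚ
sumQ = foldr _+_ 0ℚ

LHS : (n : ℕ) (x : ℚ) → 1ℚ + x ≢ 0ℚ → ℚ
LHS n x h = (((1ℚ + x) * ½) ^q n)
  * sumQ (map (λ σ → (ofℕ 4 * x * ((1/ (1ℚ + x)) {{≢-nonZero h}} ^q 2)) ^q peaks σ)
              (perms (suc n)))

RHS : (n : ℕ) (x : ℚ) → ℚ
RHS n x = sumQ (map (λ k → ofℕ (n C k) * ((1ℚ - x) ^q (n ℕ.∸ k))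
                        * sumQ (map (λ σ → (x ^q suc (des σ)) * (ofℕ 2 ^q lrmin σ)) (perms k)))
                   (map suc (upTo n)))
          + ((1ℚ - x) ^q n)

-- Cutting a permutation at its largest (or smallest) letter x writes it as α ++ x ∷ β, where α and β
-- are arrangements of the two parts of a split of the remaining letters; des, peaks and LRmin are
-- additive under this cut up to a correction that only depends on which of α, β is empty. So the peak
-- polynomial P, the Eulerian polynomial A and G_k(x) = Σ_{σ∈𝔖_k} x^des(σ) 2^LRmin(σ) satisfy recurrences
-- of binomial-convolution type. For c = (1+x)/2 and t = 4x/(1+x)², where c²t = x and 2c = 1 + x, they
-- give c^n P_{n+1}(t) = A_{n+1}(x) (Stembridge); and A_{n+1}(x) = Σ_k C(n,k) (1-x)^{n-k} H_k with
-- H_0 = 1, H_k = x G_k(x), because both sides satisfy s_{n+1} = (1-x) s_n + 2x Σ_k C(n,k) s_k A_{n-k}.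
{-# OPTIONS --safe #-}
module Submission where

open import Data.Bool using (true; false; if_then_else_; _∧_)
open import Data.Bool.Properties using (∧-zeroʳ)
open import Data.Empty using (⊥; ⊥-elim)
open import Data.Fin using (Fin; toℕ; fromℕ<)
import Data.Fin.Properties as FinP
open import Data.Integer as ℤ using ()
import Data.Integer.Properties as ℤP
open import Data.Integer.Solver using (module +-*-Solver)
open import Data.List using (List; []; _∷_; _++_; map; concatMap; length; upTo; downFrom; applyUpTo; allFin)
open import Data.List.Properties
  using (length-++; length-map; length-upTo; ∷-injectiveˡ; ∷-injectiveʳ; ++-cancelˡ; map-injective)
open import Data.List.Membership.Propositional using (_∈_; _∉_; find; lose)
open import Data.List.Membership.Propositional.Properties
  using (∈-∃++; ∈-++⁺ˡ; ∈-++⁺ʳ; ∈-++⁻; ∈-map⁺; ∈-map⁻; ∈-concatMap⁺; ∈-concatMap⁻; ∈-filter⁺; ∈-filter⁻;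
         ∈-allFin; ∈-upTo⁺; ∈-upTo⁻; ∈-downFrom⁺; ∈-downFrom⁻)
open import Data.List.Membership.Propositional.Properties.WithK using (unique∧set⇒bag)
open import Data.List.Relation.Binary.BagAndSetEquality using (∼bag⇒↭)
open import Data.List.Relation.Binary.Permutation.Propositional using (_↭_; ↭⇒↭ₛ; ↭-refl; ↭-sym; ↭-trans; ↭-prep)
import Data.List.Relation.Binary.Permutation.Propositional.Properties as ↭
import Data.List.Relation.Binary.Permutation.Setoid.Properties as ↭ₛ
open import Data.List.Relation.Unary.All as All using (All; []; _∷_)
import Data.List.Relation.Unary.All.Properties as AllP
open import Data.List.Relation.Unary.AllPairs using (AllPairs; []; _∷_)
import Data.List.Relation.Unary.AllPairs.Properties as AllPairsP
open import Data.List.Relation.Unary.Any using (here; there)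
open import Data.List.Relation.Unary.Unique.Propositional using (Unique)
import Data.List.Relation.Unary.Unique.Propositional.Properties as UniqP
import Data.List.Relation.Unary.Unique.DecPropositional as UDP
open import Data.Nat as ℕ using (ℕ; zero; suc; _≤_; _<_; _<ᵇ_; z≤n; s≤s)
open import Data.Nat.Combinatorics using (_C_; nCk+nC[k+1]≡[n+1]C[k+1]; k>n⇒nCk≡0)
open import Data.Nat.Induction using (<-rec)
import Data.Nat.Properties as ℕP
open import Data.List.Membership.DecPropositional ℕP._≟_ using (_∈?_)
open import Data.Product using (_×_; _,_; proj₁; proj₂; ∃; map₁; map₂)
open import Data.Rational using (ℚ; 0ℚ; 1ℚ; _+_; _*_; _-_; ½; 1/_; ≢-nonZero; toℚᵘ)
open import Data.Rational.Properties
open import Data.Rational.Solver renaming (module +-*-Solver to ℚ-Solver)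
import Data.Rational.Unnormalised as ℚᵘ
import Data.Rational.Unnormalised.Properties as ℚᵘP
open import Data.Sum using (_⊎_; inj₁; inj₂)
open import Data.Vec using (Vec; []; _∷_; toList)
import Data.Vec.Properties as VecP
open import Function using (_∘_; id)
open import Function.Bundles using (mk⇔)
open import Relation.Binary.PropositionalEquality
open import Relation.Nullary using (yes; no)

open import Defs

-- Finite sums and the binomial convolution

sumOver : {A : Set} → List A → (A → ℚ) → ℚ
sumOver xs f = sumQ (map f xs)

sumOver-++ : {A : Set} (xs ys : List A) (f : A → ℚ) → sumOver (xs ++ ys) f ≡ sumOver xs f + sumOver ys f
sumOver-++ []       ys f = sym (+-identityˡ (sumOver ys f))
sumOver-++ (x ∷ xs) ys f = trans (cong (f x +_) (sumOver-++ xs ys f)) (sym (+-assoc (f x) _ _))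

sumOver-map : {A B : Set} (g : A → B) (xs : List A) (f : B → ℚ) → sumOver (map g xs) f ≡ sumOver xs (λ a → f (g a))
sumOver-map g []       f = refl
sumOver-map g (x ∷ xs) f = cong (f (g x) +_) (sumOver-map g xs f)

sumOver-concatMap : {A B : Set} (g : A → List B) (xs : List A) (f : B → ℚ) →
  sumOver (concatMap g xs) f ≡ sumOver xs (λ a → sumOver (g a) f)
sumOver-concatMap g []       f = refl
sumOver-concatMap g (x ∷ xs) f = trans (sumOver-++ (g x) (concatMap g xs) f) (cong (sumOver (g x) f +_) (sumOver-concatMap g xs f))

sumOver-cong : {A : Set} (xs : List A) {f g : A → ℚ} → (∀ {a} → a ∈ xs → f a ≡ g a) → sumOver xs f ≡ sumOver xs g
sumOver-cong []       eq = refl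
sumOver-cong (x ∷ xs) eq = cong₂ _+_ (eq (here refl)) (sumOver-cong xs (eq ∘ there))

sumOver-*ˡ : {A : Set} (xs : List A) (c : ℚ) (f : A → ℚ) → sumOver xs (λ a → c * f a) ≡ c * sumOver xs f
sumOver-*ˡ []       c f = sym (*-zeroʳ c)
sumOver-*ˡ (x ∷ xs) c f = trans (cong (c * f x +_) (sumOver-*ˡ xs c f)) (sym (*-distribˡ-+ c (f x) _))

sumOver-*ʳ : {A : Set} (xs : List A) (c : ℚ) (f : A → ℚ) → sumOver xs (λ a → f a * c) ≡ sumOver xs f * c
sumOver-*ʳ []       c f = sym (*-zeroˡ c)
sumOver-*ʳ (x ∷ xs) c f = trans (cong (f x * c +_) (sumOver-*ʳ xs c f)) (sym (*-distribʳ-+ c (f x) _))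

sumOver-↭ : {A : Set} {xs ys : List A} (f : A → ℚ) → xs ↭ ys → sumOver xs f ≡ sumOver ys f
sumOver-↭ f p = ↭ₛ.foldr-commMonoid (setoid ℚ) +-0-isCommutativeMonoid (↭⇒↭ₛ (↭.map⁺ f p))

sumOver-product : {A B : Set} (xs : List A) (ys : List B) (f : A → ℚ) (g : B → ℚ) →
  sumOver xs (λ a → sumOver ys (λ b → f a * g b)) ≡ sumOver xs f * sumOver ys g
sumOver-product xs ys f g = trans (sumOver-cong xs (λ {a} _ → sumOver-*ˡ ys (f a) g)) (sumOver-*ʳ xs (sumOver ys g) f)

ofℕ-+ : ∀ a b → ofℕ (a ℕ.+ b) ≡ ofℕ a + ofℕ b
ofℕ-+ a b = toℚᵘ-injective (begin
    toℚᵘ (ofℕ (a ℕ.+ b))              ≈⟨ toℚᵘ-fromℚᵘ (ℚᵘ.mkℚᵘ (ℤ.+ (a ℕ.+ b)) 0) ⟩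
    ℚᵘ.mkℚᵘ (ℤ.+ (a ℕ.+ b)) 0         ≈⟨ ℚᵘ.*≡* integerIdentity ⟩
    ℚᵘ.mkℚᵘ (ℤ.+ a) 0 ℚᵘ.+ ℚᵘ.mkℚᵘ (ℤ.+ b) 0
      ≈⟨ ℚᵘP.+-cong (ℚᵘP.≃-sym (toℚᵘ-fromℚᵘ (ℚᵘ.mkℚᵘ (ℤ.+ a) 0)))
                    (ℚᵘP.≃-sym (toℚᵘ-fromℚᵘ (ℚᵘ.mkℚᵘ (ℤ.+ b) 0))) ⟩
    toℚᵘ (ofℕ a) ℚᵘ.+ toℚᵘ (ofℕ b)    ≈⟨ ℚᵘP.≃-sym (toℚᵘ-homo-+ (ofℕ a) (ofℕ b)) ⟩
    toℚᵘ (ofℕ a + ofℕ b)              ∎)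
  where
  open ℚᵘP.≃-Reasoning
  open +-*-Solver
  integerIdentity : ℤ.+ (a ℕ.+ b) ℤ.* (ℤ.+ 1 ℤ.* ℤ.+ 1) ≡ (ℤ.+ a ℤ.* ℤ.+ 1 ℤ.+ ℤ.+ b ℤ.* ℤ.+ 1) ℤ.* ℤ.+ 1
  integerIdentity = trans (cong (ℤ._* (ℤ.+ 1 ℤ.* ℤ.+ 1)) (ℤP.pos-+ a b))
    (solve 2 (λ p q → (p :+ q) :* (con (ℤ.+ 1) :* con (ℤ.+ 1)) := (p :* con (ℤ.+ 1) :+ q :* con (ℤ.+ 1)) :* con (ℤ.+ 1))
             refl (ℤ.+ a) (ℤ.+ b))

^q-+ : ∀ q a b → q ^q (a ℕ.+ b) ≡ q ^q a * q ^q b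
^q-+ q zero    b = sym (*-identityˡ (q ^q b))
^q-+ q (suc a) b = trans (cong (q *_) (^q-+ q a b)) (sym (*-assoc q (q ^q a) (q ^q b)))

sumTo : ℕ → (ℕ → ℚ) → ℚ
sumTo zero    f = 0ℚ
sumTo (suc n) f = f 0 + sumTo n (f ∘ suc)

sumTo-cong : ∀ n {f g : ℕ → ℚ} → (∀ {k} → k < n → f k ≡ g k) → sumTo n f ≡ sumTo n g
sumTo-cong zero    eq = refl
sumTo-cong (suc n) eq = cong₂ _+_ (eq (s≤s z≤n)) (sumTo-cong n (eq ∘ s≤s))

sumTo-+ : ∀ n (f g : ℕ → ℚ) → sumTo n (λ k → f k + g k) ≡ sumTo n f + sumTo n g
sumTo-+ zero    f g = sym (+-identityˡ 0ℚ)
sumTo-+ (suc n) f g = trans (cong (f 0 + g 0 +_) (sumTo-+ n (f ∘ suc) (g ∘ suc)))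
  (solve 4 (λ a b c d → (a :+ b) :+ (c :+ d) := (a :+ c) :+ (b :+ d)) refl (f 0) (g 0) (sumTo n (f ∘ suc)) (sumTo n (g ∘ suc)))
  where open ℚ-Solver

sumTo-last : ∀ n (f : ℕ → ℚ) → sumTo (suc n) f ≡ sumTo n f + f n
sumTo-last zero    f = trans (+-identityʳ (f 0)) (sym (+-identityˡ (f 0)))
sumTo-last (suc n) f = trans (cong (f 0 +_) (sumTo-last n (f ∘ suc))) (sym (+-assoc (f 0) _ _))

sumOver-applyUpTo : ∀ (h : ℕ → ℕ) n (g : ℕ → ℚ) → sumOver (applyUpTo h n) g ≡ sumTo n (g ∘ h)
sumOver-applyUpTo h zero    g = refl
sumOver-applyUpTo h (suc n) g = cong (g (h 0) +_) (sumOver-applyUpTo (h ∘ suc) n g)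

-- binomialSum Ψ n = Σ_{i+j=n} C(n,i) Ψ i j (binomialSum-explicit); defining it by Pascal's rule
-- makes the Leibniz rule for the binomial convolution _⋆_ hold by definition.
binomialSum : (ℕ → ℕ → ℚ) → ℕ → ℚ
binomialSum Ψ zero    = Ψ 0 0
binomialSum Ψ (suc n) = binomialSum (λ i j → Ψ (suc i) j) n + binomialSum (λ i j → Ψ i (suc j)) n

binomialSum-cong : ∀ n {Ψ Φ : ℕ → ℕ → ℚ} → (∀ i j → i ℕ.+ j ≡ n → Ψ i j ≡ Φ i j) →
  binomialSum Ψ n ≡ binomialSum Φ n
binomialSum-cong zero    eq = eq 0 0 refl
binomialSum-cong (suc n) eq = cong₂ _+_
  (binomialSum-cong n (λ i j e → eq (suc i) j (cong suc e)))
  (binomialSum-cong n (λ i j e → eq i (suc j) (trans (ℕP.+-suc i j) (cong suc e))))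

binomialSum-+ : ∀ n (Ψ Φ : ℕ → ℕ → ℚ) → binomialSum (λ i j → Ψ i j + Φ i j) n ≡ binomialSum Ψ n + binomialSum Φ n
binomialSum-+ zero    Ψ Φ = refl
binomialSum-+ (suc n) Ψ Φ = trans
  (cong₂ _+_ (binomialSum-+ n (λ i j → Ψ (suc i) j) (λ i j → Φ (suc i) j))
             (binomialSum-+ n (λ i j → Ψ i (suc j)) (λ i j → Φ i (suc j))))
  (solve 4 (λ a b c d → (a :+ b) :+ (c :+ d) := (a :+ c) :+ (b :+ d)) refl
    (binomialSum (λ i j → Ψ (suc i) j) n) (binomialSum (λ i j → Φ (suc i) j) n)
    (binomialSum (λ i j → Ψ i (suc j)) n) (binomialSum (λ i j → Φ i (suc j)) n))
  where open ℚ-Solver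

binomialSum-*ˡ : ∀ n c (Ψ : ℕ → ℕ → ℚ) → binomialSum (λ i j → c * Ψ i j) n ≡ c * binomialSum Ψ n
binomialSum-*ˡ zero    c Ψ = refl
binomialSum-*ˡ (suc n) c Ψ = trans
  (cong₂ _+_ (binomialSum-*ˡ n c (λ i j → Ψ (suc i) j)) (binomialSum-*ˡ n c (λ i j → Ψ i (suc j))))
  (sym (*-distribˡ-+ c (binomialSum (λ i j → Ψ (suc i) j) n) (binomialSum (λ i j → Ψ i (suc j)) n)))

binomialSum-zero : ∀ n → binomialSum (λ _ _ → 0ℚ) n ≡ 0ℚ
binomialSum-zero zero    = refl
binomialSum-zero (suc n) = cong₂ _+_ (binomialSum-zero n) (binomialSum-zero n)

whenZero : ℕ → ℚ → ℚ
whenZero zero    q = q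
whenZero (suc _) q = 0ℚ

binomialSum-whenZeroˡ : ∀ n (φ : ℕ → ℚ) → binomialSum (λ i j → whenZero i (φ j)) n ≡ φ n
binomialSum-whenZeroˡ zero    φ = refl
binomialSum-whenZeroˡ (suc n) φ =
  trans (cong₂ _+_ (binomialSum-zero n) (binomialSum-whenZeroˡ n (φ ∘ suc))) (+-identityˡ (φ (suc n)))

binomialSum-whenZeroʳ : ∀ n (φ : ℕ → ℚ) → binomialSum (λ i j → whenZero j (φ i)) n ≡ φ n
binomialSum-whenZeroʳ zero    φ = refl
binomialSum-whenZeroʳ (suc n) φ =
  trans (cong₂ _+_ (binomialSum-whenZeroʳ n (φ ∘ suc)) (binomialSum-zero n)) (+-identityʳ (φ (suc n)))

ofℕ-Pascal : ∀ n k → ofℕ (suc n C suc k) ≡ ofℕ (n C k) + ofℕ (n C suc k)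
ofℕ-Pascal n k = trans (cong ofℕ (sym (nCk+nC[k+1]≡[n+1]C[k+1] n k))) (ofℕ-+ (n C k) (n C suc k))

binomialSum-explicit : ∀ n Ψ → binomialSum Ψ n ≡ sumTo (suc n) (λ k → ofℕ (n C k) * Ψ k (n ℕ.∸ k))
binomialSum-explicit zero    Ψ = sym (trans (+-identityʳ (1ℚ * Ψ 0 0)) (*-identityˡ (Ψ 0 0)))
binomialSum-explicit (suc n) Ψ = begin
  binomialSum Ψ₁ n + binomialSum Ψ₂ n
    ≡⟨ cong₂ _+_ (binomialSum-explicit n Ψ₁) (binomialSum-explicit n Ψ₂) ⟩
  sumTo (suc n) left + (1ℚ * Ψ 0 (suc n) + sumTo n (λ k → ofℕ (n C suc k) * Ψ (suc k) (suc (n ℕ.∸ suc k))))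
    ≡⟨ cong (λ w → sumTo (suc n) left + (1ℚ * Ψ 0 (suc n) + w)) rightShifted ⟩
  sumTo (suc n) left + (1ℚ * Ψ 0 (suc n) + sumTo (suc n) right)
    ≡⟨ solve 3 (λ a b c → a :+ (b :+ c) := b :+ (a :+ c)) refl (sumTo (suc n) left) (1ℚ * Ψ 0 (suc n)) (sumTo (suc n) right) ⟩
  1ℚ * Ψ 0 (suc n) + (sumTo (suc n) left + sumTo (suc n) right)
    ≡⟨ cong (1ℚ * Ψ 0 (suc n) +_) (sym (sumTo-+ (suc n) left right)) ⟩
  1ℚ * Ψ 0 (suc n) + sumTo (suc n) (λ k → left k + right k)
    ≡⟨ cong (1ℚ * Ψ 0 (suc n) +_) (sumTo-cong (suc n) (λ {k} _ → pascal k)) ⟩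
  sumTo (suc (suc n)) (λ k → ofℕ (suc n C k) * Ψ k (suc n ℕ.∸ k)) ∎
  where
  open ≡-Reasoning
  open ℚ-Solver
  Ψ₁ Ψ₂ : ℕ → ℕ → ℚ
  Ψ₁ i j = Ψ (suc i) j
  Ψ₂ i j = Ψ i (suc j)
  left right : ℕ → ℚ
  left  k = ofℕ (n C k) * Ψ (suc k) (n ℕ.∸ k)
  right k = ofℕ (n C suc k) * Ψ (suc k) (n ℕ.∸ k)
  pascal : ∀ k → left k + right k ≡ ofℕ (suc n C suc k) * Ψ (suc k) (n ℕ.∸ k)
  pascal k = trans (sym (*-distribʳ-+ (Ψ (suc k) (n ℕ.∸ k)) (ofℕ (n C k)) (ofℕ (n C suc k))))
                   (cong (_* Ψ (suc k) (n ℕ.∸ k)) (sym (ofℕ-Pascal n k)))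
  lastVanishes : right n ≡ 0ℚ
  lastVanishes = trans (cong (λ c → ofℕ c * Ψ (suc n) (n ℕ.∸ n)) (k>n⇒nCk≡0 (ℕP.n<1+n n)))
                       (*-zeroˡ (Ψ (suc n) (n ℕ.∸ n)))
  rightShifted : sumTo n (λ k → ofℕ (n C suc k) * Ψ (suc k) (suc (n ℕ.∸ suc k))) ≡ sumTo (suc n) right
  rightShifted = begin
    sumTo n (λ k → ofℕ (n C suc k) * Ψ (suc k) (suc (n ℕ.∸ suc k)))
      ≡⟨ sumTo-cong n (λ {k} k<n → cong (λ m → ofℕ (n C suc k) * Ψ (suc k) m) (sym (ℕP.+-∸-assoc 1 k<n))) ⟩
    sumTo n right                 ≡⟨ sym (+-identityʳ (sumTo n right)) ⟩
    sumTo n right + 0ℚ            ≡⟨ cong (sumTo n right +_) (sym lastVanishes) ⟩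
    sumTo n right + right n       ≡⟨ sym (sumTo-last n right) ⟩
    sumTo (suc n) right           ∎

infixl 7 _⋆_
_⋆_ : (ℕ → ℚ) → (ℕ → ℚ) → ℕ → ℚ
(f ⋆ g) = binomialSum (λ i j → f i * g j)

⋆-comm : ∀ f g n → (f ⋆ g) n ≡ (g ⋆ f) n
⋆-comm f g zero    = *-comm (f 0) (g 0)
⋆-comm f g (suc n) = trans (cong₂ _+_ (⋆-comm (f ∘ suc) g n) (⋆-comm f (g ∘ suc) n))
                           (+-comm ((g ⋆ f ∘ suc) n) ((g ∘ suc ⋆ f) n))

⋆-distribʳ-+ : ∀ f₁ f₂ g n → ((λ i → f₁ i + f₂ i) ⋆ g) n ≡ (f₁ ⋆ g) n + (f₂ ⋆ g) n
⋆-distribʳ-+ f₁ f₂ g n =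
  trans (binomialSum-cong n (λ i j _ → *-distribʳ-+ (g j) (f₁ i) (f₂ i))) (binomialSum-+ n _ _)

⋆-distribˡ-+ : ∀ f g₁ g₂ n → (f ⋆ (λ j → g₁ j + g₂ j)) n ≡ (f ⋆ g₁) n + (f ⋆ g₂) n
⋆-distribˡ-+ f g₁ g₂ n =
  trans (binomialSum-cong n (λ i j _ → *-distribˡ-+ (f i) (g₁ j) (g₂ j))) (binomialSum-+ n _ _)

*-⋆ : ∀ c f g n → ((λ i → c * f i) ⋆ g) n ≡ c * (f ⋆ g) n
*-⋆ c f g n = trans (binomialSum-cong n (λ i j _ → *-assoc c (f i) (g j))) (binomialSum-*ˡ n c _)

⋆-* : ∀ c f g n → (f ⋆ (λ j → c * g j)) n ≡ c * (f ⋆ g) n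
⋆-* c f g n = trans (binomialSum-cong n (λ i j _ → solve 3 (λ a b c → a :* (c :* b) := c :* (a :* b)) refl (f i) (g j) c))
                    (binomialSum-*ˡ n c _)
  where open ℚ-Solver

⋆-assoc : ∀ f g h n → ((f ⋆ g) ⋆ h) n ≡ (f ⋆ (g ⋆ h)) n
⋆-assoc f g h zero    = *-assoc (f 0) (g 0) (h 0)
⋆-assoc f g h (suc n) = begin
  ((f ⋆ g) ∘ suc ⋆ h) n + ((f ⋆ g) ⋆ h ∘ suc) n
    ≡⟨ cong (_+ ((f ⋆ g) ⋆ h ∘ suc) n) (⋆-distribʳ-+ (f ∘ suc ⋆ g) (f ⋆ g ∘ suc) h n) ⟩
  ((f ∘ suc ⋆ g) ⋆ h) n + ((f ⋆ g ∘ suc) ⋆ h) n + ((f ⋆ g) ⋆ h ∘ suc) n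
    ≡⟨ cong₂ _+_ (cong₂ _+_ (⋆-assoc (f ∘ suc) g h n) (⋆-assoc f (g ∘ suc) h n)) (⋆-assoc f g (h ∘ suc) n) ⟩
  (f ∘ suc ⋆ (g ⋆ h)) n + (f ⋆ (g ∘ suc ⋆ h)) n + (f ⋆ (g ⋆ h ∘ suc)) n
    ≡⟨ +-assoc ((f ∘ suc ⋆ (g ⋆ h)) n) ((f ⋆ (g ∘ suc ⋆ h)) n) ((f ⋆ (g ⋆ h ∘ suc)) n) ⟩
  (f ∘ suc ⋆ (g ⋆ h)) n + ((f ⋆ (g ∘ suc ⋆ h)) n + (f ⋆ (g ⋆ h ∘ suc)) n)
    ≡⟨ cong ((f ∘ suc ⋆ (g ⋆ h)) n +_) (sym (⋆-distribˡ-+ f (g ∘ suc ⋆ h) (g ⋆ h ∘ suc) n)) ⟩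
  (f ∘ suc ⋆ (g ⋆ h)) n + (f ⋆ (g ⋆ h) ∘ suc) n ∎
  where open ≡-Reasoning

-- Splits and arrangements of a list

∈-concatMap⁺′ : {A B : Set} (g : A → List B) {xs : List A} {a : A} {b : B} → a ∈ xs → b ∈ g a → b ∈ concatMap g xs
∈-concatMap⁺′ g a∈ b∈ = ∈-concatMap⁺ g (lose a∈ b∈)

∈-concatMap⁻′ : {A B : Set} (g : A → List B) {xs : List A} {b : B} → b ∈ concatMap g xs → ∃ λ a → a ∈ xs × b ∈ g a
∈-concatMap⁻′ g b∈ = find (∈-concatMap⁻ g b∈)

Unique-concatMap : {A B : Set} (g : A → List B) {xs : List A} → Unique xs → (∀ {a} → a ∈ xs → Unique (g a)) →
  (∀ {a a′ b} → a ∈ xs → a′ ∈ xs → b ∈ g a → b ∈ g a′ → a ≡ a′) → Unique (concatMap g xs)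
Unique-concatMap g {[]}     _          _  _  = []
Unique-concatMap g {a ∷ xs} (a∉ ∷ uxs) ug dj =
  UniqP.++⁺ (ug (here refl)) (Unique-concatMap g uxs (ug ∘ there) (λ p q → dj (there p) (there q))) disjoint
  where
  disjoint : ∀ {b} → b ∈ g a × b ∈ concatMap g xs → ⊥
  disjoint (b∈ , b∈′) with a′ , a′∈ , b∈a′ ← ∈-concatMap⁻′ g b∈′ =
    All.lookup a∉ a′∈ (dj (here refl) (there a′∈) b∈ b∈a′)

module _ {A : Set} where

  Unique-↭ : {xs ys : List A} → Unique xs → Unique ys →
    (∀ {z} → z ∈ xs → z ∈ ys) → (∀ {z} → z ∈ ys → z ∈ xs) → xs ↭ ys
  Unique-↭ uxs uys to from = ∼bag⇒↭ (unique∧set⇒bag uxs uys (mk⇔ to from))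

  Unique-resp-↭ : {xs ys : List A} → xs ↭ ys → Unique xs → Unique ys
  Unique-resp-↭ p = ↭ₛ.Unique-resp-↭ (setoid A) (↭⇒↭ₛ p)

  Unique-++⁻ : (xs : List A) {ys : List A} → Unique (xs ++ ys) → Unique xs × Unique ys
  Unique-++⁻ []       u       = [] , u
  Unique-++⁻ (x ∷ xs) (h ∷ u) = AllP.++⁻ˡ xs h ∷ proj₁ (Unique-++⁻ xs u) , proj₂ (Unique-++⁻ xs u)

  ∈⇒↭∷ : {x : A} {xs : List A} → x ∈ xs → ∃ λ ys → xs ↭ x ∷ ys
  ∈⇒↭∷ {x} x∈xs with ys , zs , refl ← ∈-∃++ x∈xs = ys ++ zs , ↭.shift x ys zs

  Unique⇒length≤ : {xs ys : List A} → Unique xs → (∀ {z} → z ∈ xs → z ∈ ys) → length xs ≤ length ys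
  Unique⇒length≤ {[]}     _         _   = z≤n
  Unique⇒length≤ {x ∷ xs} (x∉ ∷ u) sub with ys′ , ys↭ ← ∈⇒↭∷ (sub (here refl)) =
    subst (suc (length xs) ≤_) (sym (↭.↭-length ys↭)) (s≤s (Unique⇒length≤ u sub′))
    where
    sub′ : ∀ {z} → z ∈ xs → z ∈ ys′
    sub′ {z} z∈xs with ↭.∈-resp-↭ ys↭ (sub (there z∈xs))
    ... | here z≡x = ⊥-elim (All.lookup x∉ z∈xs (sym z≡x))
    ... | there z∈ = z∈

  splits : List A → List (List A × List A)
  splits []      = ([] , []) ∷ []
  splits (y ∷ S) = map (map₁ (y ∷_)) (splits S) ++ map (map₂ (y ∷_)) (splits S)

  splits-∷⁺ˡ : ∀ {y S L R} → (L , R) ∈ splits S → (y ∷ L , R) ∈ splits (y ∷ S)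
  splits-∷⁺ˡ {y} p = ∈-++⁺ˡ (∈-map⁺ (map₁ (y ∷_)) p)

  splits-∷⁺ʳ : ∀ {y S L R} → (L , R) ∈ splits S → (L , y ∷ R) ∈ splits (y ∷ S)
  splits-∷⁺ʳ {y} {S} p = ∈-++⁺ʳ (map (map₁ (y ∷_)) (splits S)) (∈-map⁺ (map₂ (y ∷_)) p)

  splits-∷⁻ : ∀ {y S L R} → (L , R) ∈ splits (y ∷ S) →
    (∃ λ L′ → L ≡ y ∷ L′ × (L′ , R) ∈ splits S) ⊎ (∃ λ R′ → R ≡ y ∷ R′ × (L , R′) ∈ splits S)
  splits-∷⁻ {y} {S} p with ∈-++⁻ (map (map₁ (y ∷_)) (splits S)) p
  ... | inj₁ q with (L′ , _) , r , refl ← ∈-map⁻ (map₁ (y ∷_)) q = inj₁ (L′ , refl , r)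
  ... | inj₂ q with (_ , R′) , r , refl ← ∈-map⁻ (map₂ (y ∷_)) q = inj₂ (R′ , refl , r)

  splits-↭ : ∀ S {L R} → (L , R) ∈ splits S → L ++ R ↭ S
  splits-↭ []      (here refl) = ↭-refl
  splits-↭ (y ∷ S) p with splits-∷⁻ {y} {S} p
  ... | inj₁ (_  , refl , q) = ↭-prep y (splits-↭ S q)
  ... | inj₂ (R′ , refl , q) = ↭-trans (↭.shift y _ R′) (↭-prep y (splits-↭ S q))

  splits-length : ∀ S {L R} → (L , R) ∈ splits S → length L ℕ.+ length R ≡ length S
  splits-length S {L} p = trans (sym (length-++ L)) (↭.↭-length (splits-↭ S p))

  splits-⊆ˡ : ∀ S {L R} → (L , R) ∈ splits S → ∀ {z} → z ∈ L → z ∈ S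
  splits-⊆ˡ S p z∈ = ↭.∈-resp-↭ (splits-↭ S p) (∈-++⁺ˡ z∈)

  splits-⊆ʳ : ∀ S {L R} → (L , R) ∈ splits S → ∀ {z} → z ∈ R → z ∈ S
  splits-⊆ʳ S {L} p z∈ = ↭.∈-resp-↭ (splits-↭ S p) (∈-++⁺ʳ L z∈)

  splits-complete : ∀ S {α β} → α ++ β ↭ S → ∃ λ LR → LR ∈ splits S × α ↭ proj₁ LR × β ↭ proj₂ LR
  splits-complete [] {α} {β} p with ↭.↭-empty-inv p
  splits-complete [] {[]} {[]} p | refl = ([] , []) , here refl , ↭-refl , ↭-refl
  splits-complete (y ∷ S) {α} {β} p with ∈-++⁻ α (↭.∈-resp-↭ (↭-sym p) (here refl))
  ... | inj₁ y∈α with α′ , α↭ ← ∈⇒↭∷ y∈α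
                  with (L , R) , q , α′↭L , β↭R ← splits-complete S (↭.drop-∷ (↭-trans (↭-sym (↭.++⁺ʳ β α↭)) p))
    = (y ∷ L , R) , splits-∷⁺ˡ {y} {S} q , ↭-trans α↭ (↭-prep y α′↭L) , β↭R
  ... | inj₂ y∈β with β′ , β↭ ← ∈⇒↭∷ y∈β
                  with (L , R) , q , α↭L , β′↭R ←
                         splits-complete S (↭.drop-∷ (↭-trans (↭-sym (↭.shift y α β′))
                                                              (↭-trans (↭-sym (↭.++⁺ˡ α β↭)) p)))
    = (L , y ∷ R) , splits-∷⁺ʳ {y} {S} q , α↭L , ↭-trans β↭ (↭-prep y β′↭R)

  splits-unique : ∀ S → Unique S → Unique (splits S)
  splits-unique []      _          = [] ∷ []
  splits-unique (y ∷ S) (y∉ ∷ uS) =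
    UniqP.++⁺ (UniqP.map⁺ map₁-injective (splits-unique S uS)) (UniqP.map⁺ map₂-injective (splits-unique S uS)) disjoint
    where
    map₁-injective : ∀ {p q : List A × List A} → map₁ (y ∷_) p ≡ map₁ (y ∷_) q → p ≡ q
    map₁-injective {_ , _} {_ , _} refl = refl
    map₂-injective : ∀ {p q : List A × List A} → map₂ (y ∷_) p ≡ map₂ (y ∷_) q → p ≡ q
    map₂-injective {_ , _} {_ , _} refl = refl
    disjoint : ∀ {v} → v ∈ map (map₁ (y ∷_)) (splits S) × v ∈ map (map₂ (y ∷_)) (splits S) → ⊥
    disjoint (p , q) with _ , _ , refl ← ∈-map⁻ (map₁ (y ∷_)) p | _ , r , refl ← ∈-map⁻ (map₂ (y ∷_)) q
      = All.lookup y∉ (splits-⊆ˡ S r (here refl)) refl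

  splits-determined : ∀ S → Unique S → ∀ {L R L′ R′} → (L , R) ∈ splits S → (L′ , R′) ∈ splits S →
    L ↭ L′ → (L , R) ≡ (L′ , R′)
  splits-determined []      _          (here refl) (here refl) _ = refl
  splits-determined (y ∷ S) (y∉ ∷ uS) p p′ L↭L′ with splits-∷⁻ {y} {S} p | splits-∷⁻ {y} {S} p′
  ... | inj₁ (_ , refl , q) | inj₁ (_ , refl , q′)
    with refl ← splits-determined S uS q q′ (↭.drop-∷ L↭L′) = refl
  ... | inj₁ (_ , refl , q) | inj₂ (_ , refl , q′) =
    ⊥-elim (All.lookup y∉ (splits-⊆ˡ S q′ (↭.∈-resp-↭ L↭L′ (here refl))) refl)
  ... | inj₂ (_ , refl , q) | inj₁ (_ , refl , q′) =
    ⊥-elim (All.lookup y∉ (splits-⊆ˡ S q (↭.∈-resp-↭ (↭-sym L↭L′) (here refl))) refl)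
  ... | inj₂ (_ , refl , q) | inj₂ (_ , refl , q′)
    with refl ← splits-determined S uS q q′ L↭L′ = refl

  sumOver-splits : ∀ S (Ψ : ℕ → ℕ → ℚ) →
    sumOver (splits S) (λ LR → Ψ (length (proj₁ LR)) (length (proj₂ LR))) ≡ binomialSum Ψ (length S)
  sumOver-splits []      Ψ = +-identityʳ (Ψ 0 0)
  sumOver-splits (y ∷ S) Ψ = trans (sumOver-++ (map (map₁ (y ∷_)) (splits S)) (map (map₂ (y ∷_)) (splits S)) _)
    (cong₂ _+_ (trans (sumOver-map (map₁ (y ∷_)) (splits S) _) (sumOver-splits S (λ i j → Ψ (suc i) j)))
               (trans (sumOver-map (map₂ (y ∷_)) (splits S) _) (sumOver-splits S (λ i j → Ψ i (suc j)))))

  splits-AllPairs : ∀ {_~_ : A → A → Set} S → AllPairs _~_ S → ∀ {L R} → (L , R) ∈ splits S →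
    AllPairs _~_ L × AllPairs _~_ R
  splits-AllPairs []      _           (here refl) = [] , []
  splits-AllPairs (y ∷ S) (y~S ∷ sS) LR∈ with splits-∷⁻ {y} {S} LR∈
  ... | inj₁ (_ , refl , q) =
    All.tabulate (All.lookup y~S ∘ splits-⊆ˡ S q) ∷ proj₁ (splits-AllPairs S sS q) , proj₂ (splits-AllPairs S sS q)
  ... | inj₂ (_ , refl , q) =
    proj₁ (splits-AllPairs S sS q) , All.tabulate (All.lookup y~S ∘ splits-⊆ʳ S q) ∷ proj₂ (splits-AllPairs S sS q)

  -- arrangements f D lists the permutations of D, each written as α ++ x ∷ β where x is the head
  -- of D and α, β are arrangements of the two parts of a split of its tail; the fuel f must be at
  -- least length D.
  arrangements : ℕ → List A → List (List A)
  arrangementsAround : ℕ → A → List A × List A → List (List A)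

  arrangements f       []      = [] ∷ []
  arrangements zero    (x ∷ S) = []
  arrangements (suc f) (x ∷ S) = concatMap (arrangementsAround f x) (splits S)

  arrangementsAround f x (L , R) = concatMap (λ α → map (λ β → α ++ x ∷ β) (arrangements f R)) (arrangements f L)

  ∈-arrangementsAround⁻ : ∀ {f x L R τ} → τ ∈ arrangementsAround f x (L , R) →
    ∃ λ α → ∃ λ β → α ∈ arrangements f L × β ∈ arrangements f R × τ ≡ α ++ x ∷ β
  ∈-arrangementsAround⁻ {f} {x} {L} {R} τ∈
    with α , α∈ , τ∈′ ← ∈-concatMap⁻′ (λ α → map (λ β → α ++ x ∷ β) (arrangements f R)) τ∈
    with β , β∈ , refl ← ∈-map⁻ (λ β → α ++ x ∷ β) τ∈′ = α , β , α∈ , β∈ , refl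

  arrangements-↭ : ∀ f D {τ} → τ ∈ arrangements f D → τ ↭ D
  arrangements-↭ f       []      (here refl) = ↭-refl
  arrangements-↭ (suc f) (x ∷ S) τ∈
    with (L , R) , LR∈ , τ∈′ ← ∈-concatMap⁻′ (arrangementsAround f x) τ∈
    with α , β , α∈ , β∈ , refl ← ∈-arrangementsAround⁻ {f} {x} {L} {R} τ∈′ =
    ↭-trans (↭.shift x α β)
            (↭-prep x (↭-trans (↭.++⁺ (arrangements-↭ f L α∈) (arrangements-↭ f R β∈)) (splits-↭ S LR∈)))

  arrangements-complete : ∀ f D {τ} → length D ≤ f → τ ↭ D → τ ∈ arrangements f D
  arrangements-complete f [] _ τ↭ with refl ← ↭.↭-empty-inv τ↭ = here refl
  arrangements-complete (suc f) (x ∷ S) (s≤s |S|≤f) τ↭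
    with α , β , refl ← ∈-∃++ (↭.∈-resp-↭ (↭-sym τ↭) (here refl))
    with (L , R) , LR∈ , α↭L , β↭R ← splits-complete S (↭.drop-∷ (↭-trans (↭-sym (↭.shift x α β)) τ↭)) =
    ∈-concatMap⁺′ (arrangementsAround f x) LR∈
      (∈-concatMap⁺′ (λ α → map (λ β → α ++ x ∷ β) (arrangements f R)) (arrangements-complete f L |L|≤f α↭L)
        (∈-map⁺ (λ β → α ++ x ∷ β) (arrangements-complete f R |R|≤f β↭R)))
    where
    |L|+|R|≤f : length L ℕ.+ length R ≤ f
    |L|+|R|≤f = subst (_≤ f) (sym (splits-length S LR∈)) |S|≤f
    |L|≤f : length L ≤ f
    |L|≤f = ℕP.≤-trans (ℕP.m≤m+n (length L) (length R)) |L|+|R|≤f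
    |R|≤f : length R ≤ f
    |R|≤f = ℕP.≤-trans (ℕP.m≤n+m (length R) (length L)) |L|+|R|≤f

  ++-∷-cancel : ∀ {x : A} α α′ {β β′} → x ∉ α → x ∉ α′ →
    α ++ x ∷ β ≡ α′ ++ x ∷ β′ → α ≡ α′ × β ≡ β′
  ++-∷-cancel []      []        _  _  eq = refl , ∷-injectiveʳ eq
  ++-∷-cancel []      (a ∷ α′)  _  x∉ eq = ⊥-elim (x∉ (here (∷-injectiveˡ eq)))
  ++-∷-cancel (a ∷ α) []        x∉ _  eq = ⊥-elim (x∉ (here (sym (∷-injectiveˡ eq))))
  ++-∷-cancel (a ∷ α) (a′ ∷ α′) x∉ x∉′ eq with refl ← ∷-injectiveˡ eq
    with refl , refl ← ++-∷-cancel α α′ (x∉ ∘ there) (x∉′ ∘ there) (∷-injectiveʳ eq) = refl , refl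

  arrangements-unique : ∀ f D → Unique D → Unique (arrangements f D)
  arrangements-unique f       []      _          = [] ∷ []
  arrangements-unique zero    (x ∷ S) _          = []
  arrangements-unique (suc f) (x ∷ S) (x∉ ∷ uS) =
    Unique-concatMap (arrangementsAround f x) (splits-unique S uS) uniqueAround differentSplits
    where
    x∉left : ∀ {L R α} → (L , R) ∈ splits S → α ∈ arrangements f L → x ∉ α
    x∉left {L} LR∈ α∈ z∈ = All.lookup x∉ (splits-⊆ˡ S LR∈ (↭.∈-resp-↭ (arrangements-↭ f L α∈) z∈)) refl
    uniqueAround : ∀ {LR} → LR ∈ splits S → Unique (arrangementsAround f x LR)
    uniqueAround {L , R} LR∈ =
      Unique-concatMap (λ α → map (λ β → α ++ x ∷ β) (arrangements f R)) (arrangements-unique f L uL)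
        (λ {α} _ → UniqP.map⁺ (λ eq → ∷-injectiveʳ (++-cancelˡ α _ _ eq)) (arrangements-unique f R uR))
        sameLeft
      where
      uL×uR : Unique L × Unique R
      uL×uR = Unique-++⁻ L (Unique-resp-↭ (↭-sym (splits-↭ S LR∈)) uS)
      uL : Unique L
      uL = proj₁ uL×uR
      uR : Unique R
      uR = proj₂ uL×uR
      sameLeft : ∀ {α α′ τ} → α ∈ arrangements f L → α′ ∈ arrangements f L →
        τ ∈ map (λ β → α ++ x ∷ β) (arrangements f R) → τ ∈ map (λ β → α′ ++ x ∷ β) (arrangements f R) →
        α ≡ α′
      sameLeft {α} {α′} α∈ α′∈ τ∈ τ∈′
        with _ , _ , eq ← ∈-map⁻ (λ β → α ++ x ∷ β) τ∈ | _ , _ , eq′ ← ∈-map⁻ (λ β → α′ ++ x ∷ β) τ∈′ =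
        proj₁ (++-∷-cancel α α′ (x∉left LR∈ α∈) (x∉left LR∈ α′∈) (trans (sym eq) eq′))
    differentSplits : ∀ {LR LR′ τ} → LR ∈ splits S → LR′ ∈ splits S →
      τ ∈ arrangementsAround f x LR → τ ∈ arrangementsAround f x LR′ → LR ≡ LR′
    differentSplits {L , R} {L′ , R′} LR∈ LR′∈ τ∈ τ∈′
      with α , _ , α∈ , _ , refl ← ∈-arrangementsAround⁻ {f} {x} {L} {R} τ∈
      with α′ , _ , α′∈ , _ , eq ← ∈-arrangementsAround⁻ {f} {x} {L′} {R′} τ∈′
      with refl , _ ← ++-∷-cancel α α′ (x∉left LR∈ α∈) (x∉left LR′∈ α′∈) eq =
      splits-determined S uS LR∈ LR′∈ (↭-trans (↭-sym (arrangements-↭ f L α∈)) (arrangements-↭ f L′ α′∈))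

-- The permutations of [m]

toℕs : {m k : ℕ} → Vec (Fin m) k → List ℕ
toℕs v = map toℕ (toList v)

allVecs-complete : ∀ m k (v : Vec (Fin m) k) → v ∈ allVecs m k
allVecs-complete m zero    []      = here refl
allVecs-complete m (suc k) (i ∷ v) =
  ∈-concatMap⁺′ (λ i → map (i ∷_) (allVecs m k)) (∈-allFin i) (∈-map⁺ (i ∷_) (allVecs-complete m k v))

allVecs-unique : ∀ m k → Unique (allVecs m k)
allVecs-unique m zero    = [] ∷ []
allVecs-unique m (suc k) =
  Unique-concatMap (λ i → map (i ∷_) (allVecs m k)) (UniqP.allFin⁺ m)
    (λ _ → UniqP.map⁺ VecP.∷-injectiveʳ (allVecs-unique m k)) sameHead
  where
  sameHead : ∀ {i i′ v} → i ∈ allFin m → i′ ∈ allFin m →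
    v ∈ map (i ∷_) (allVecs m k) → v ∈ map (i′ ∷_) (allVecs m k) → i ≡ i′
  sameHead {i} {i′} _ _ v∈ v∈′ with _ , _ , refl ← ∈-map⁻ (i ∷_) v∈ | _ , _ , eq ← ∈-map⁻ (i′ ∷_) v∈′ =
    VecP.∷-injectiveˡ eq

perms-unique : ∀ m → Unique (perms m)
perms-unique m = UniqP.map⁺ toℕs-injective (UniqP.filter⁺ (λ v → UDP.unique? (FinP._≟_ {m}) (toList v)) (allVecs-unique m m))
  where
  toℕs-injective : ∀ {v w : Vec (Fin m) m} → toℕs v ≡ toℕs w → v ≡ w
  toℕs-injective {v} {w} eq =
    trans (sym (VecP.cast-is-id refl v)) (VecP.toList-injective refl v w (map-injective FinP.toℕ-injective eq))

module _ {m : ℕ} where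

  finsOf : (τ : List ℕ) → All (_< m) τ → Vec (Fin m) (length τ)
  finsOf []      []          = []
  finsOf (z ∷ τ) (z<m ∷ τ<m) = fromℕ< z<m ∷ finsOf τ τ<m

  toℕs-finsOf : (τ : List ℕ) (τ<m : All (_< m) τ) → toℕs (finsOf τ τ<m) ≡ τ
  toℕs-finsOf []      []          = refl
  toℕs-finsOf (z ∷ τ) (z<m ∷ τ<m) = cong₂ _∷_ (FinP.toℕ-fromℕ< z<m) (toℕs-finsOf τ τ<m)

∈-perms⁻ : ∀ m {τ} → τ ∈ perms m → length τ ≡ m × All (_< m) τ × Unique τ
∈-perms⁻ m τ∈ with v , v∈ , refl ← ∈-map⁻ toℕs τ∈
  with _ , v-unique ← ∈-filter⁻ (λ v → UDP.unique? (FinP._≟_ {m}) (toList v)) {xs = allVecs m m} v∈ =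
  trans (length-map toℕ (toList v)) (VecP.length-toList v) ,
  AllP.map⁺ (All.universal FinP.toℕ<n (toList v)) ,
  UniqP.map⁺ FinP.toℕ-injective v-unique

∈-perms⁺ : ∀ {τ} → All (_< length τ) τ → Unique τ → τ ∈ perms (length τ)
∈-perms⁺ {τ} τ< uτ = subst (_∈ perms (length τ)) (toℕs-finsOf τ τ<)
  (∈-map⁺ toℕs (∈-filter⁺ (λ v → UDP.unique? (FinP._≟_ {length τ}) (toList v))
    (allVecs-complete (length τ) (length τ) (finsOf τ τ<))
    (UniqP.map⁻ (subst Unique (sym (toℕs-finsOf τ τ<)) uτ))))

-- The pigeonhole step: a repetition-free word of length m over [0, m) uses every letter.
∈-perms⇒↭upTo : ∀ m {τ} → τ ∈ perms m → τ ↭ upTo m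
∈-perms⇒↭upTo m {τ} τ∈ with |τ|≡m , τ<m , uτ ← ∈-perms⁻ m τ∈ =
  Unique-↭ uτ (UniqP.upTo⁺ m) (∈-upTo⁺ ∘ All.lookup τ<m) (everyLetterUsed ∘ ∈-upTo⁻)
  where
  everyLetterUsed : ∀ {z} → z < m → z ∈ τ
  everyLetterUsed {z} z<m with z ∈? τ
  ... | yes z∈τ = z∈τ
  ... | no  z∉τ with rest , upTo↭ ← ∈⇒↭∷ (∈-upTo⁺ {n = m} z<m) =
    ⊥-elim (ℕP.<-irrefl refl (ℕP.≤-trans |rest|<m (subst (_≤ length rest) |τ|≡m (Unique⇒length≤ uτ τ⊆rest))))
    where
    τ⊆rest : ∀ {w} → w ∈ τ → w ∈ rest
    τ⊆rest w∈τ with ↭.∈-resp-↭ upTo↭ (∈-upTo⁺ (All.lookup τ<m w∈τ))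
    ... | here refl = ⊥-elim (z∉τ w∈τ)
    ... | there w∈  = w∈
    |rest|<m : suc (length rest) ≤ m
    |rest|<m = ℕP.≤-reflexive (trans (sym (↭.↭-length upTo↭)) (length-upTo m))

↭upTo⇒∈-perms : ∀ m {τ} → τ ↭ upTo m → τ ∈ perms m
↭upTo⇒∈-perms m {τ} τ↭ = subst (λ k → τ ∈ perms k) |τ|≡m
  (∈-perms⁺ (All.tabulate (λ z∈τ → subst (_ <_) (sym |τ|≡m) (∈-upTo⁻ (↭.∈-resp-↭ τ↭ z∈τ))))
            (Unique-resp-↭ (↭-sym τ↭) (UniqP.upTo⁺ m)))
  where
  |τ|≡m : length τ ≡ m
  |τ|≡m = trans (↭.↭-length τ↭) (length-upTo m)

perms↭arrangements : ∀ m {D} → D ↭ upTo m → perms m ↭ arrangements m D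
perms↭arrangements m {D} D↭ = Unique-↭ (perms-unique m) (arrangements-unique m D (Unique-resp-↭ (↭-sym D↭) (UniqP.upTo⁺ m)))
  (λ τ∈ → arrangements-complete m D |D|≤m (↭-trans (∈-perms⇒↭upTo m τ∈) (↭-sym D↭)))
  (λ τ∈ → ↭upTo⇒∈-perms m (↭-trans (arrangements-↭ m D τ∈) D↭))
  where
  |D|≤m : length D ≤ m
  |D|≤m = ℕP.≤-reflexive (trans (↭.↭-length D↭) (length-upTo m))

-- Statistics of a permutation cut at its largest or smallest letter

<⇒<ᵇ≡true : ∀ {m n} → m < n → (m <ᵇ n) ≡ true
<⇒<ᵇ≡true {zero}  {suc n} _       = refl
<⇒<ᵇ≡true {suc m} {suc n} (s≤s p) = <⇒<ᵇ≡true p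

≤⇒<ᵇ≡false : ∀ {m n} → n ≤ m → (m <ᵇ n) ≡ false
≤⇒<ᵇ≡false {m}     {zero}  _       = refl
≤⇒<ᵇ≡false {suc m} {suc n} (s≤s p) = ≤⇒<ᵇ≡false p

isPositive : ℕ → ℕ
isPositive zero    = 0
isPositive (suc _) = 1

bothPositive : ℕ → ℕ → ℕ
bothPositive (suc _) (suc _) = 1
bothPositive _       _       = 0

+-reassoc : ∀ c a b d → c ℕ.+ (a ℕ.+ b ℕ.+ d) ≡ c ℕ.+ a ℕ.+ b ℕ.+ d
+-reassoc c a b d = trans (sym (ℕP.+-assoc c (a ℕ.+ b) d)) (cong (ℕ._+ d) (sym (ℕP.+-assoc c a b)))

des-insertMax : ∀ x α β → All (_< x) α → All (_< x) β →
  des (α ++ x ∷ β) ≡ des α ℕ.+ des β ℕ.+ isPositive (length β)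
des-insertMax x []           []      _             _         = refl
des-insertMax x []           (b ∷ β) _             (b<x ∷ _) rewrite <⇒<ᵇ≡true b<x = ℕP.+-comm 1 (des (b ∷ β))
des-insertMax x (a ∷ [])     β       (a<x ∷ _)     β<x       rewrite ≤⇒<ᵇ≡false {x} {a} (ℕP.<⇒≤ a<x) =
  des-insertMax x [] β [] β<x
des-insertMax x (a ∷ a′ ∷ α) β       (_ ∷ α<x)     β<x       =
  trans (cong ((if a′ <ᵇ a then 1 else 0) ℕ.+_) (des-insertMax x (a′ ∷ α) β α<x β<x))
        (+-reassoc (if a′ <ᵇ a then 1 else 0) (des (a′ ∷ α)) (des β) (isPositive (length β)))

des-insertMin : ∀ x α β → All (x <_) α → All (x <_) β →
  des (α ++ x ∷ β) ≡ des α ℕ.+ des β ℕ.+ isPositive (length α)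
des-insertMin x []           []      _         _         = refl
des-insertMin x []           (b ∷ β) _         (x<b ∷ _) rewrite ≤⇒<ᵇ≡false {b} {x} (ℕP.<⇒≤ x<b) =
  sym (ℕP.+-identityʳ (des (b ∷ β)))
des-insertMin x (a ∷ [])     β       (x<a ∷ _) x<β       rewrite <⇒<ᵇ≡true x<a =
  trans (cong suc (trans (des-insertMin x [] β [] x<β) (ℕP.+-identityʳ (des β)))) (ℕP.+-comm 1 (des β))
des-insertMin x (a ∷ a′ ∷ α) β       (_ ∷ x<α) x<β       =
  trans (cong ((if a′ <ᵇ a then 1 else 0) ℕ.+_) (des-insertMin x (a′ ∷ α) β x<α x<β))
        (+-reassoc (if a′ <ᵇ a then 1 else 0) (des (a′ ∷ α)) (des β) 1)

peaks-maxFirst : ∀ x β → All (_< x) β → peaks (x ∷ β) ≡ peaks β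
peaks-maxFirst x []           _         = refl
peaks-maxFirst x (b ∷ [])     _         = refl
peaks-maxFirst x (b ∷ b′ ∷ β) (b<x ∷ _) rewrite ≤⇒<ᵇ≡false {x} {b} (ℕP.<⇒≤ b<x) = refl

bothPositive-suc : ∀ m m′ n → bothPositive (suc m) n ≡ bothPositive (suc m′) n
bothPositive-suc m m′ zero    = refl
bothPositive-suc m m′ (suc n) = refl

peaks-insertMax-singleton : ∀ x a β → a < x → All (_< x) β →
  peaks (a ∷ x ∷ β) ≡ peaks β ℕ.+ bothPositive 1 (length β)
peaks-insertMax-singleton x a []      _   _           = refl
peaks-insertMax-singleton x a (b ∷ β) a<x (b<x ∷ β<x) rewrite <⇒<ᵇ≡true a<x | <⇒<ᵇ≡true b<x =
  trans (cong suc (peaks-maxFirst x (b ∷ β) (b<x ∷ β<x))) (ℕP.+-comm 1 (peaks (b ∷ β)))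

peaks-insertMax : ∀ x α β → All (_< x) α → All (_< x) β →
  peaks (α ++ x ∷ β) ≡ peaks α ℕ.+ peaks β ℕ.+ bothPositive (length α) (length β)
peaks-insertMax x []       β _         β<x = trans (peaks-maxFirst x β β<x) (sym (ℕP.+-identityʳ (peaks β)))
peaks-insertMax x (a ∷ []) β (a<x ∷ _) β<x = peaks-insertMax-singleton x a β a<x β<x
peaks-insertMax x (a ∷ a′ ∷ []) β (_ ∷ a′<x ∷ _) β<x
  rewrite ≤⇒<ᵇ≡false {x} {a′} (ℕP.<⇒≤ a′<x) | ∧-zeroʳ (a <ᵇ a′) =
  trans (peaks-insertMax-singleton x a′ β a′<x β<x) (cong (peaks β ℕ.+_) (bothPositive-suc 0 1 (length β)))
peaks-insertMax x (a ∷ a′ ∷ a″ ∷ α) β (_ ∷ α<x) β<x =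
  trans (cong (peakAt ℕ.+_) (peaks-insertMax x (a′ ∷ a″ ∷ α) β α<x β<x))
    (trans (+-reassoc peakAt (peaks (a′ ∷ a″ ∷ α)) (peaks β) (bothPositive (suc (suc (length α))) (length β)))
           (cong (peakAt ℕ.+ peaks (a′ ∷ a″ ∷ α) ℕ.+ peaks β ℕ.+_)
                 (bothPositive-suc (suc (length α)) (suc (suc (length α))) (length β))))
  where
  peakAt : ℕ
  peakAt = if (a <ᵇ a′) ∧ (a″ <ᵇ a′) then 1 else 0

lrminFrom-above : ∀ m β → All (m <_) β → lrminFrom m β ≡ 0
lrminFrom-above m []      _           = refl
lrminFrom-above m (b ∷ β) (m<b ∷ m<β) rewrite ≤⇒<ᵇ≡false {b} {m} (ℕP.<⇒≤ m<b) = lrminFrom-above m β m<β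

lrminFrom-insertMin : ∀ x m α β → x < m → All (x <_) α → All (x <_) β → lrminFrom m (α ++ x ∷ β) ≡ suc (lrminFrom m α)
lrminFrom-insertMin x m []      β x<m _         x<β rewrite <⇒<ᵇ≡true x<m = cong suc (lrminFrom-above x β x<β)
lrminFrom-insertMin x m (a ∷ α) β x<m (x<a ∷ x<α) x<β with a <ᵇ m
... | true  = cong suc (lrminFrom-insertMin x a α β x<a x<α x<β)
... | false = lrminFrom-insertMin x m α β x<m x<α x<β

lrmin-insertMin : ∀ x α β → All (x <_) α → All (x <_) β → lrmin (α ++ x ∷ β) ≡ suc (lrmin α)
lrmin-insertMin x []      β _           x<β = cong suc (lrminFrom-above x β x<β)
lrmin-insertMin x (a ∷ α) β (x<a ∷ x<α) x<β = cong suc (lrminFrom-insertMin x a α β x<a x<α x<β)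

-- Cutting at the pivot (the maximum for x ≻ z = z < x, the minimum for x ≻ z = x < z) leaves
-- arrangements of arbitrary sets of letters, so the recurrence is proved together with
-- RelabellingInvariant: a sum over the arrangements of a ≻-sorted list only depends on its length.
module PivotRecurrence
  (_≻_ : ℕ → ℕ → Set)
  (pivotOrder : ℕ → List ℕ)
  (pivotOrder-sorted : ∀ n → AllPairs _≻_ (pivotOrder n))
  (pivotOrder↭upTo : ∀ n → pivotOrder n ↭ upTo n)
  where

  total : (List ℕ → ℚ) → ℕ → ℚ
  total F n = sumOver (perms n) F

  record Factorises (F H : List ℕ → ℚ) (κ : ℕ → ℕ → ℚ) : Set where
    constructor mkFactorises
    field
      cut-at-pivot : ∀ x α β → All (x ≻_) α → All (x ≻_) β → F (α ++ x ∷ β) ≡ κ (length α) (length β) * F α * H β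

  RelabellingInvariant : (List ℕ → ℚ) → ℕ → Set
  RelabellingInvariant F n = ∀ f D → AllPairs _≻_ D → length D ≡ n → n ≤ f → sumOver (arrangements f D) F ≡ total F n

  RelabellingInvariantBelow : (List ℕ → ℚ) → ℕ → Set
  RelabellingInvariantBelow F n = ∀ {k} → k < n → RelabellingInvariant F k

  module _ {F H : List ℕ → ℚ} {κ : ℕ → ℕ → ℚ} (factorises : Factorises F H κ) where

    open Factorises factorises

    sumOver-arrangements-∷ : ∀ f x S → AllPairs _≻_ (x ∷ S) → length S ≤ f →
      RelabellingInvariantBelow F (suc (length S)) → RelabellingInvariantBelow H (suc (length S)) →
      sumOver (arrangements (suc f) (x ∷ S)) F ≡ binomialSum (λ i j → κ i j * total F i * total H j) (length S)
    sumOver-arrangements-∷ f x S (x≻S ∷ sS) |S|≤f invF invH = begin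
      sumOver (concatMap (arrangementsAround f x) (splits S)) F
        ≡⟨ sumOver-concatMap (arrangementsAround f x) (splits S) F ⟩
      sumOver (splits S) (λ LR → sumOver (arrangementsAround f x LR) F)
        ≡⟨ sumOver-cong (splits S) aroundSplit ⟩
      sumOver (splits S) (λ LR → term (length (proj₁ LR)) (length (proj₂ LR)))
        ≡⟨ sumOver-splits S term ⟩
      binomialSum term (length S) ∎
      where
      open ≡-Reasoning
      term : ℕ → ℕ → ℚ
      term i j = κ i j * total F i * total H j
      aroundSplit : ∀ {LR} → LR ∈ splits S →
        sumOver (arrangementsAround f x LR) F ≡ term (length (proj₁ LR)) (length (proj₂ LR))
      aroundSplit {L , R} LR∈ = begin
        sumOver (concatMap (λ α → map (λ β → α ++ x ∷ β) (arrangements f R)) (arrangements f L)) F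
          ≡⟨ sumOver-concatMap (λ α → map (λ β → α ++ x ∷ β) (arrangements f R)) (arrangements f L) F ⟩
        sumOver (arrangements f L) (λ α → sumOver (map (λ β → α ++ x ∷ β) (arrangements f R)) F)
          ≡⟨ sumOver-cong (arrangements f L) (λ {α} α∈ → trans (sumOver-map (λ β → α ++ x ∷ β) (arrangements f R) F)
                                                             (sumOver-cong (arrangements f R) (factorisesAt α∈))) ⟩
        sumOver (arrangements f L) (λ α → sumOver (arrangements f R) (λ β → (k * F α) * H β))
          ≡⟨ sumOver-product (arrangements f L) (arrangements f R) (λ α → k * F α) H ⟩
        sumOver (arrangements f L) (λ α → k * F α) * sumOver (arrangements f R) H
          ≡⟨ cong (_* sumOver (arrangements f R) H) (sumOver-*ˡ (arrangements f L) k F) ⟩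
        k * sumOver (arrangements f L) F * sumOver (arrangements f R) H
          ≡⟨ cong₂ (λ u v → k * u * v) (invF |L|<  f L sL refl |L|≤f) (invH |R|< f R sR refl |R|≤f) ⟩
        k * total F (length L) * total H (length R) ∎
        where
        k : ℚ
        k = κ (length L) (length R)
        sL : AllPairs _≻_ L
        sL = proj₁ (splits-AllPairs S sS LR∈)
        sR : AllPairs _≻_ R
        sR = proj₂ (splits-AllPairs S sS LR∈)
        |L|+|R|≡|S| : length L ℕ.+ length R ≡ length S
        |L|+|R|≡|S| = splits-length S LR∈
        |L|< : length L < suc (length S)
        |L|< = s≤s (subst (length L ≤_) |L|+|R|≡|S| (ℕP.m≤m+n (length L) (length R)))
        |R|< : length R < suc (length S)
        |R|< = s≤s (subst (length R ≤_) |L|+|R|≡|S| (ℕP.m≤n+m (length R) (length L)))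
        |L|≤f : length L ≤ f
        |L|≤f = ℕP.≤-trans (ℕP.≤-pred |L|<) |S|≤f
        |R|≤f : length R ≤ f
        |R|≤f = ℕP.≤-trans (ℕP.≤-pred |R|<) |S|≤f
        x≻arrangement : ∀ {P α} → (∀ {z} → z ∈ P → z ∈ S) → α ∈ arrangements f P → All (x ≻_) α
        x≻arrangement {P} P⊆S α∈ = All.tabulate (All.lookup x≻S ∘ P⊆S ∘ ↭.∈-resp-↭ (arrangements-↭ f P α∈))
        factorisesAt : ∀ {α β} → α ∈ arrangements f L → β ∈ arrangements f R → F (α ++ x ∷ β) ≡ (k * F α) * H β
        factorisesAt {α} {β} α∈ β∈ = trans
          (cut-at-pivot x α β (x≻arrangement (splits-⊆ˡ S LR∈) α∈) (x≻arrangement (splits-⊆ʳ S LR∈) β∈))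
          (cong₂ (λ i j → κ i j * F α * H β) (↭.↭-length (arrangements-↭ f L α∈))
                                              (↭.↭-length (arrangements-↭ f R β∈)))

    total-suc : ∀ m → RelabellingInvariantBelow F (suc m) → RelabellingInvariantBelow H (suc m) →
      total F (suc m) ≡ binomialSum (λ i j → κ i j * total F i * total H j) m
    total-suc m invF invH with pivotOrder (suc m) | pivotOrder-sorted (suc m) | pivotOrder↭upTo (suc m)
    ... | [] | _ | D↭ with () ← trans (↭.↭-length D↭) (length-upTo (suc m))
    ... | x ∷ S | sorted | D↭ with refl ← ℕP.suc-injective (trans (↭.↭-length D↭) (length-upTo (suc m))) =
      trans (sumOver-↭ F (perms↭arrangements (suc m) D↭)) (sumOver-arrangements-∷ m x S sorted ℕP.≤-refl invF invH)

    relabellingInvariant : (∀ {n} → RelabellingInvariantBelow F n → RelabellingInvariantBelow H n) →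
      ∀ n → RelabellingInvariant F n
    relabellingInvariant invH⇐invF = <-rec (RelabellingInvariant F) step
      where
      step : ∀ n → RelabellingInvariantBelow F n → RelabellingInvariant F n
      step zero    _    f       []      _      _      _           = refl
      step (suc m) invF (suc f) (x ∷ S) sorted |D|≡n (s≤s m≤f) with refl ← ℕP.suc-injective |D|≡n =
        trans (sumOver-arrangements-∷ f x S sorted m≤f invF (invH⇐invF invF))
              (sym (total-suc (length S) invF (invH⇐invF invF)))

    total-recurrence : (∀ {n} → RelabellingInvariantBelow F n → RelabellingInvariantBelow H n) → ∀ m →
      total F (suc m) ≡ binomialSum (λ i j → κ i j * total F i * total H j) m
    total-recurrence invH⇐invF m = total-suc m invF (invH⇐invF invF)
      where
      invF : RelabellingInvariantBelow F (suc m)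
      invF _ = relabellingInvariant invH⇐invF _

downFrom-sorted : ∀ n → AllPairs (λ x z → z < x) (downFrom n)
downFrom-sorted n = AllPairsP.applyDownFrom⁺₁ id n (λ j<i _ → j<i)

upTo-sorted : ∀ n → AllPairs _<_ (upTo n)
upTo-sorted n = AllPairsP.applyUpTo⁺₁ id n (λ i<j _ → i<j)

downFrom↭upTo : ∀ n → downFrom n ↭ upTo n
downFrom↭upTo n = Unique-↭ (UniqP.downFrom⁺ n) (UniqP.upTo⁺ n) (∈-upTo⁺ ∘ ∈-downFrom⁻) (∈-downFrom⁺ ∘ ∈-upTo⁻)

module MaxPivot = PivotRecurrence (λ x z → z < x) downFrom downFrom-sorted downFrom↭upTo
module MinPivot = PivotRecurrence _<_ upTo upTo-sorted (λ _ → ↭-refl)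

eulerian : ℚ → ℕ → ℚ
eulerian w n = sumOver (perms n) (λ σ → w ^q des σ)

peakPolynomial : ℚ → ℕ → ℚ
peakPolynomial t n = sumOver (perms n) (λ σ → t ^q peaks σ)

desLrminPolynomial : ℚ → ℕ → ℚ
desLrminPolynomial w n = sumOver (perms n) (λ σ → w ^q des σ * ofℕ 2 ^q lrmin σ)

^q-+-+ : ∀ q a b c → q ^q (a ℕ.+ b ℕ.+ c) ≡ q ^q c * q ^q a * q ^q b
^q-+-+ q a b c = trans (^q-+ q (a ℕ.+ b) c) (trans (cong (_* q ^q c) (^q-+ q a b))
  (solve 3 (λ x y z → x :* y :* z := z :* x :* y) refl (q ^q a) (q ^q b) (q ^q c)))
  where open ℚ-Solver

des-factorises-atMax : ∀ w → MaxPivot.Factorises (λ σ → w ^q des σ) (λ σ → w ^q des σ) (λ _ j → w ^q isPositive j)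
des-factorises-atMax w = MaxPivot.mkFactorises λ x α β α<x β<x →
  trans (cong (w ^q_) (des-insertMax x α β α<x β<x)) (^q-+-+ w (des α) (des β) (isPositive (length β)))

des-factorises-atMin : ∀ w → MinPivot.Factorises (λ σ → w ^q des σ) (λ σ → w ^q des σ) (λ i _ → w ^q isPositive i)
des-factorises-atMin w = MinPivot.mkFactorises λ x α β x<α x<β →
  trans (cong (w ^q_) (des-insertMin x α β x<α x<β)) (^q-+-+ w (des α) (des β) (isPositive (length α)))

peaks-factorises : ∀ t → MaxPivot.Factorises (λ σ → t ^q peaks σ) (λ σ → t ^q peaks σ) (λ i j → t ^q bothPositive i j)
peaks-factorises t = MaxPivot.mkFactorises λ x α β α<x β<x →
  trans (cong (t ^q_) (peaks-insertMax x α β α<x β<x)) (^q-+-+ t (peaks α) (peaks β) (bothPositive (length α) (length β)))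

desLrmin-factorises : ∀ w → MinPivot.Factorises (λ σ → w ^q des σ * ofℕ 2 ^q lrmin σ) (λ σ → w ^q des σ)
                                                 (λ i _ → ofℕ 2 * w ^q isPositive i)
desLrmin-factorises w = MinPivot.mkFactorises λ x α β x<α x<β → begin
  w ^q des (α ++ x ∷ β) * ofℕ 2 ^q lrmin (α ++ x ∷ β)
    ≡⟨ cong₂ (λ d l → w ^q d * ofℕ 2 ^q l) (des-insertMin x α β x<α x<β) (lrmin-insertMin x α β x<α x<β) ⟩
  w ^q (des α ℕ.+ des β ℕ.+ isPositive (length α)) * (ofℕ 2 * ofℕ 2 ^q lrmin α)
    ≡⟨ cong (_* (ofℕ 2 * ofℕ 2 ^q lrmin α)) (^q-+-+ w (des α) (des β) (isPositive (length α))) ⟩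
  w ^q isPositive (length α) * w ^q des α * w ^q des β * (ofℕ 2 * ofℕ 2 ^q lrmin α)
    ≡⟨ solve 5 (λ c a b t l → c :* a :* b :* (t :* l) := t :* c :* (a :* l) :* b) refl
         (w ^q isPositive (length α)) (w ^q des α) (w ^q des β) (ofℕ 2) (ofℕ 2 ^q lrmin α) ⟩
  ofℕ 2 * w ^q isPositive (length α) * (w ^q des α * ofℕ 2 ^q lrmin α) * w ^q des β ∎
  where
  open ≡-Reasoning
  open ℚ-Solver

eulerian-recurrence : ∀ w m → eulerian w (suc m) ≡ binomialSum (λ i j → w ^q isPositive j * eulerian w i * eulerian w j) m
eulerian-recurrence w = MaxPivot.total-recurrence (des-factorises-atMax w) (λ inv → inv)

peakPolynomial-recurrence : ∀ t m →
  peakPolynomial t (suc m) ≡ binomialSum (λ i j → t ^q bothPositive i j * peakPolynomial t i * peakPolynomial t j) m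
peakPolynomial-recurrence t = MaxPivot.total-recurrence (peaks-factorises t) (λ inv → inv)

desLrminPolynomial-recurrence : ∀ w m →
  desLrminPolynomial w (suc m) ≡ binomialSum (λ i j → ofℕ 2 * w ^q isPositive i * desLrminPolynomial w i * eulerian w j) m
desLrminPolynomial-recurrence w = MinPivot.total-recurrence (desLrmin-factorises w)
  (λ _ _ → MinPivot.relabellingInvariant (des-factorises-atMin w) (λ inv → inv) _)

-- Stembridge's identity

module _ {c t x : ℚ} (c*c*t≡x : c * c * t ≡ x) (c+c≡1+x : c + c ≡ 1ℚ + x) where

  private
    P A : ℕ → ℚ
    P = peakPolynomial t
    A = eulerian x

  -- Summand by summand, up to boundary terms that cancel because (c - x) + (c - 1) = 0.
  peakSummand-eulerianSummand : ∀ m → (∀ {k} → k < suc m → c ^q k * P (suc k) ≡ A (suc k)) →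
    ∀ i j → i ℕ.+ j ≡ suc m →
    c ^q (i ℕ.+ j) * (t ^q bothPositive i j * P i * P j)
      ≡ x ^q isPositive j * A i * A j + (whenZero i ((c - x) * A j) + whenZero j ((c - 1ℚ) * A i))
  peakSummand-eulerianSummand m ih zero (suc j) refl = begin
    c * c ^q j * (1ℚ * 1ℚ * P (suc j))
      ≡⟨ solve 3 (λ c d p → c :* d :* (con 1ℚ :* con 1ℚ :* p) := c :* (d :* p)) refl c (c ^q j) (P (suc j)) ⟩
    c * (c ^q j * P (suc j))
      ≡⟨ cong (c *_) (ih ℕP.≤-refl) ⟩
    c * A (suc j)
      ≡⟨ solve 3 (λ x c a → c :* a := x :* con 1ℚ :* con 1ℚ :* a :+ ((c :- x) :* a :+ con 0ℚ)) refl x c (A (suc j)) ⟩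
    x * 1ℚ * 1ℚ * A (suc j) + ((c - x) * A (suc j) + 0ℚ) ∎
    where
    open ≡-Reasoning
    open ℚ-Solver
  peakSummand-eulerianSummand m ih (suc i) zero refl = begin
    c ^q (suc i ℕ.+ 0) * (1ℚ * P (suc i) * 1ℚ)
      ≡⟨ cong (λ k → c ^q k * (1ℚ * P (suc i) * 1ℚ)) (ℕP.+-identityʳ (suc i)) ⟩
    c * c ^q i * (1ℚ * P (suc i) * 1ℚ)
      ≡⟨ solve 3 (λ c d p → c :* d :* (con 1ℚ :* p :* con 1ℚ) := c :* (d :* p)) refl c (c ^q i) (P (suc i)) ⟩
    c * (c ^q i * P (suc i))
      ≡⟨ cong (c *_) (ih (s≤s (ℕP.m≤m+n i 0))) ⟩
    c * A (suc i)
      ≡⟨ solve 2 (λ c a → c :* a := con 1ℚ :* a :* con 1ℚ :+ (con 0ℚ :+ (c :- con 1ℚ) :* a)) refl c (A (suc i)) ⟩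
    1ℚ * A (suc i) * 1ℚ + (0ℚ + (c - 1ℚ) * A (suc i)) ∎
    where
    open ≡-Reasoning
    open ℚ-Solver
  peakSummand-eulerianSummand m ih (suc i) (suc j) refl = begin
    c * c ^q (i ℕ.+ suc j) * (t * 1ℚ * P (suc i) * P (suc j))
      ≡⟨ cong (λ e → c * e * (t * 1ℚ * P (suc i) * P (suc j))) (^q-+ c i (suc j)) ⟩
    c * (c ^q i * (c * c ^q j)) * (t * 1ℚ * P (suc i) * P (suc j))
      ≡⟨ solve 6 (λ c ci cj t p q → c :* (ci :* (c :* cj)) :* (t :* con 1ℚ :* p :* q) := c :* c :* t :* (ci :* p) :* (cj :* q))
           refl c (c ^q i) (c ^q j) t (P (suc i)) (P (suc j)) ⟩
    c * c * t * (c ^q i * P (suc i)) * (c ^q j * P (suc j))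
      ≡⟨ cong₂ _*_ (cong₂ _*_ c*c*t≡x (ih (s≤s (ℕP.m≤m+n i (suc j)))))
                   (ih (s≤s (ℕP.≤-trans (ℕP.n≤1+n j) (ℕP.m≤n+m (suc j) i)))) ⟩
    x * A (suc i) * A (suc j)
      ≡⟨ solve 3 (λ x a b → x :* a :* b := x :* con 1ℚ :* a :* b :+ (con 0ℚ :+ con 0ℚ)) refl x (A (suc i)) (A (suc j)) ⟩
    x * 1ℚ * A (suc i) * A (suc j) + (0ℚ + 0ℚ) ∎
    where
    open ≡-Reasoning
    open ℚ-Solver

  peakPolynomial-eulerian : ∀ m → c ^q m * P (suc m) ≡ A (suc m)
  peakPolynomial-eulerian = <-rec _ step
    where
    step : ∀ m → (∀ {k} → k < m → c ^q k * P (suc k) ≡ A (suc k)) → c ^q m * P (suc m) ≡ A (suc m)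
    step zero    _  = refl
    step (suc m) ih = begin
      c ^q suc m * P (suc (suc m))
        ≡⟨ cong (c ^q suc m *_) (peakPolynomial-recurrence t (suc m)) ⟩
      c ^q suc m * binomialSum peakTerm (suc m)
        ≡⟨ sym (binomialSum-*ˡ (suc m) (c ^q suc m) peakTerm) ⟩
      binomialSum (λ i j → c ^q suc m * peakTerm i j) (suc m)
        ≡⟨ binomialSum-cong (suc m) (λ i j i+j≡ → trans (cong (λ k → c ^q k * peakTerm i j) (sym i+j≡))
                                                        (peakSummand-eulerianSummand m ih i j i+j≡)) ⟩
      binomialSum (λ i j → eulerianTerm i j + boundaryTerm i j) (suc m)
        ≡⟨ binomialSum-+ (suc m) eulerianTerm boundaryTerm ⟩
      binomialSum eulerianTerm (suc m) + binomialSum boundaryTerm (suc m)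
        ≡⟨ cong₂ _+_ (sym (eulerian-recurrence x (suc m)))
                     (trans (binomialSum-+ (suc m) (λ i j → whenZero i ((c - x) * A j)) (λ i j → whenZero j ((c - 1ℚ) * A i)))
                            (cong₂ _+_ (binomialSum-whenZeroˡ (suc m) (λ j → (c - x) * A j))
                                       (binomialSum-whenZeroʳ (suc m) (λ i → (c - 1ℚ) * A i)))) ⟩
      A (suc (suc m)) + ((c - x) * A (suc m) + (c - 1ℚ) * A (suc m))
        ≡⟨ cong (A (suc (suc m)) +_) boundaryTermsCancel ⟩
      A (suc (suc m)) + 0ℚ
        ≡⟨ +-identityʳ (A (suc (suc m))) ⟩
      A (suc (suc m)) ∎
      where
      open ≡-Reasoning
      peakTerm eulerianTerm boundaryTerm : ℕ → ℕ → ℚ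
      peakTerm     i j = t ^q bothPositive i j * P i * P j
      eulerianTerm i j = x ^q isPositive j * A i * A j
      boundaryTerm i j = whenZero i ((c - x) * A j) + whenZero j ((c - 1ℚ) * A i)
      boundaryTermsCancel : (c - x) * A (suc m) + (c - 1ℚ) * A (suc m) ≡ 0ℚ
      boundaryTermsCancel = begin
        (c - x) * A (suc m) + (c - 1ℚ) * A (suc m)
          ≡⟨ solve 3 (λ c x a → (c :- x) :* a :+ (c :- con 1ℚ) :* a := ((c :+ c) :- (con 1ℚ :+ x)) :* a) refl c x (A (suc m)) ⟩
        ((c + c) - (1ℚ + x)) * A (suc m)             ≡⟨ cong (λ e → (e - (1ℚ + x)) * A (suc m)) c+c≡1+x ⟩
        ((1ℚ + x) - (1ℚ + x)) * A (suc m)            ≡⟨ cong (_* A (suc m)) (+-inverseʳ (1ℚ + x)) ⟩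
        0ℚ * A (suc m)                               ≡⟨ *-zeroˡ (A (suc m)) ⟩
        0ℚ ∎
        where open ℚ-Solver

-- The Eulerian polynomial as a binomial convolution

desLrminTerm : ℚ → ℕ → ℚ
desLrminTerm x k = x ^q isPositive k * desLrminPolynomial x k

module _ (x : ℚ) where

  private
    A H U : ℕ → ℚ
    A = eulerian x
    H = desLrminTerm x
    U = (1ℚ - x) ^q_

  desLrminTerm-recurrence : ∀ k → H (suc k) ≡ (ofℕ 2 * x) * (H ⋆ A) k
  desLrminTerm-recurrence k = begin
    x ^q 1 * desLrminPolynomial x (suc k)
      ≡⟨ cong (x ^q 1 *_) (desLrminPolynomial-recurrence x k) ⟩
    x ^q 1 * binomialSum (λ i j → ofℕ 2 * x ^q isPositive i * desLrminPolynomial x i * A j) k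
      ≡⟨ cong (x ^q 1 *_) (binomialSum-cong k (λ i j _ → solve 4 (λ d e g a → d :* e :* g :* a := d :* (e :* g :* a)) refl
                                                             (ofℕ 2) (x ^q isPositive i) (desLrminPolynomial x i) (A j))) ⟩
    x ^q 1 * binomialSum (λ i j → ofℕ 2 * (H i * A j)) k
      ≡⟨ cong (x ^q 1 *_) (binomialSum-*ˡ k (ofℕ 2) (λ i j → H i * A j)) ⟩
    x ^q 1 * (ofℕ 2 * (H ⋆ A) k)
      ≡⟨ solve 3 (λ x d C → x :* con 1ℚ :* (d :* C) := d :* x :* C) refl x (ofℕ 2) ((H ⋆ A) k) ⟩
    ofℕ 2 * x * (H ⋆ A) k ∎
    where
    open ≡-Reasoning
    open ℚ-Solver

  eulerian-shifted-recurrence : ∀ n → A (suc (suc n)) ≡ (1ℚ - x) * A (suc n) + (ofℕ 2 * x) * ((A ∘ suc) ⋆ A) n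
  eulerian-shifted-recurrence n = begin
    A (suc (suc n))
      ≡⟨ eulerian-recurrence x (suc n) ⟩
    binomialSum (λ i j → x ^q isPositive j * A (suc i) * A j) n + binomialSum (λ i j → x ^q isPositive (suc j) * A i * A (suc j)) n
      ≡⟨ cong₂ _+_ maxFirstPart maxLaterPart ⟩
    (x * ((A ∘ suc) ⋆ A) n + (1ℚ - x) * A (suc n)) + x * ((A ∘ suc) ⋆ A) n
      ≡⟨ solve 4 (λ x u C S → x :* C :+ u :* S :+ x :* C := u :* S :+ (con (ofℕ 2) :* x) :* C)
                 refl x (1ℚ - x) (((A ∘ suc) ⋆ A) n) (A (suc n)) ⟩
    (1ℚ - x) * A (suc n) + (ofℕ 2 * x) * ((A ∘ suc) ⋆ A) n ∎
    where
    open ≡-Reasoning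
    open ℚ-Solver
    summand : ∀ i j → x ^q isPositive j * A (suc i) * A j ≡ x * (A (suc i) * A j) + whenZero j ((1ℚ - x) * A (suc i))
    summand i zero    = solve 2 (λ x S → con 1ℚ :* S :* con 1ℚ := x :* (S :* con 1ℚ) :+ (con 1ℚ :- x) :* S) refl x (A (suc i))
    summand i (suc j) = solve 3 (λ x S B → x :* con 1ℚ :* S :* B := x :* (S :* B) :+ con 0ℚ) refl x (A (suc i)) (A (suc j))
    maxFirstPart : binomialSum (λ i j → x ^q isPositive j * A (suc i) * A j) n ≡ x * ((A ∘ suc) ⋆ A) n + (1ℚ - x) * A (suc n)
    maxFirstPart = trans (binomialSum-cong n (λ i j _ → summand i j))
      (trans (binomialSum-+ n (λ i j → x * (A (suc i) * A j)) (λ i j → whenZero j ((1ℚ - x) * A (suc i))))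
        (cong₂ _+_ (binomialSum-*ˡ n x (λ i j → A (suc i) * A j)) (binomialSum-whenZeroʳ n (λ i → (1ℚ - x) * A (suc i)))))
    maxLaterPart : binomialSum (λ i j → x ^q isPositive (suc j) * A i * A (suc j)) n ≡ x * ((A ∘ suc) ⋆ A) n
    maxLaterPart = trans
      (binomialSum-cong n (λ i j _ → solve 3 (λ x a b → x :* con 1ℚ :* a :* b := x :* (a :* b)) refl x (A i) (A (suc j))))
      (trans (binomialSum-*ˡ n x (λ i j → A i * A (suc j))) (cong (x *_) (⋆-comm A (A ∘ suc) n)))

  ⋆-desLrminTerm-recurrence : ∀ n → (U ⋆ H) (suc n) ≡ (1ℚ - x) * (U ⋆ H) n + (ofℕ 2 * x) * ((U ⋆ H) ⋆ A) n
  ⋆-desLrminTerm-recurrence n = cong₂ _+_ (*-⋆ (1ℚ - x) U H n) (begin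
    (U ⋆ H ∘ suc) n                          ≡⟨ binomialSum-cong n (λ i j _ → cong (U i *_) (desLrminTerm-recurrence j)) ⟩
    (U ⋆ (λ j → (ofℕ 2 * x) * (H ⋆ A) j)) n  ≡⟨ ⋆-* (ofℕ 2 * x) U (H ⋆ A) n ⟩
    (ofℕ 2 * x) * (U ⋆ (H ⋆ A)) n            ≡⟨ cong ((ofℕ 2 * x) *_) (sym (⋆-assoc U H A n)) ⟩
    (ofℕ 2 * x) * ((U ⋆ H) ⋆ A) n            ∎)
    where open ≡-Reasoning

  eulerian-binomialConvolution : ∀ n → A (suc n) ≡ (U ⋆ H) n
  eulerian-binomialConvolution = <-rec _ step
    where
    step : ∀ n → (∀ {k} → k < n → A (suc k) ≡ (U ⋆ H) k) → A (suc n) ≡ (U ⋆ H) n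
    step zero    _  = refl
    step (suc n) ih = begin
      A (suc (suc n))                                         ≡⟨ eulerian-shifted-recurrence n ⟩
      (1ℚ - x) * A (suc n) + (ofℕ 2 * x) * ((A ∘ suc) ⋆ A) n
        ≡⟨ cong₂ (λ a b → (1ℚ - x) * a + (ofℕ 2 * x) * b) (ih ℕP.≤-refl)
                 (binomialSum-cong n (λ i j i+j≡n → cong (_* A j) (ih (s≤s (subst (i ≤_) i+j≡n (ℕP.m≤m+n i j)))))) ⟩
      (1ℚ - x) * (U ⋆ H) n + (ofℕ 2 * x) * ((U ⋆ H) ⋆ A) n    ≡⟨ sym (⋆-desLrminTerm-recurrence n) ⟩
      (U ⋆ H) (suc n) ∎
      where open ≡-Reasoning

binomialSum-RHS : ∀ n x → (desLrminTerm x ⋆ (1ℚ - x) ^q_) n ≡ RHS n x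
binomialSum-RHS n x = begin
  (H ⋆ U) n
    ≡⟨ binomialSum-explicit n (λ i j → H i * U j) ⟩
  1ℚ * (1ℚ * U n) + sumTo n (λ k → ofℕ (n C suc k) * (H (suc k) * U (n ℕ.∸ suc k)))
    ≡⟨ cong₂ _+_ (trans (*-identityˡ (1ℚ * U n)) (*-identityˡ (U n))) (sumTo-cong n (λ {k} _ → summand k)) ⟩
  U n + sumTo n (T ∘ suc)
    ≡⟨ +-comm (U n) (sumTo n (T ∘ suc)) ⟩
  sumTo n (T ∘ suc) + U n
    ≡⟨ cong (_+ U n) (sym (trans (sumOver-map suc (upTo n) T) (sumOver-applyUpTo id n (T ∘ suc)))) ⟩
  RHS n x ∎
  where
  open ≡-Reasoning
  H U T : ℕ → ℚ
  H = desLrminTerm x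
  U = (1ℚ - x) ^q_
  T k = ofℕ (n C k) * U (n ℕ.∸ k) * sumOver (perms k) (λ σ → x ^q suc (des σ) * ofℕ 2 ^q lrmin σ)
  innerSum : ∀ k → sumOver (perms k) (λ σ → x ^q suc (des σ) * ofℕ 2 ^q lrmin σ) ≡ x * desLrminPolynomial x k
  innerSum k = trans (sumOver-cong (perms k) (λ {σ} _ → *-assoc x (x ^q des σ) (ofℕ 2 ^q lrmin σ)))
                     (sumOver-*ˡ (perms k) x (λ σ → x ^q des σ * ofℕ 2 ^q lrmin σ))
  summand : ∀ k → ofℕ (n C suc k) * (H (suc k) * U (n ℕ.∸ suc k)) ≡ T (suc k)
  summand k = trans (solve 4 (λ x b g u → b :* (x :* con 1ℚ :* g :* u) := b :* u :* (x :* g)) refl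
                       x (ofℕ (n C suc k)) (desLrminPolynomial x (suc k)) (U (n ℕ.∸ suc k)))
                    (cong (ofℕ (n C suc k) * U (n ℕ.∸ suc k) *_) (sym (innerSum (suc k))))
    where open ℚ-Solver

peakWeight-identity : ∀ x (h : 1ℚ + x ≢ 0ℚ) →
  (1ℚ + x) * ½ * ((1ℚ + x) * ½) * (ofℕ 4 * x * ((1/ (1ℚ + x)) {{≢-nonZero h}} ^q 2)) ≡ x
peakWeight-identity x h = begin
  (1ℚ + x) * ½ * ((1ℚ + x) * ½) * (ofℕ 4 * x * (y * (y * 1ℚ)))
    ≡⟨ solve 2 (λ x y → ((con 1ℚ :+ x) :* con ½) :* ((con 1ℚ :+ x) :* con ½) :* (con (ofℕ 4) :* x :* (y :* (y :* con 1ℚ)))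
                        := ((con 1ℚ :+ x) :* y) :* ((con 1ℚ :+ x) :* y) :* x) refl x y ⟩
  ((1ℚ + x) * y) * ((1ℚ + x) * y) * x
    ≡⟨ cong (λ z → z * z * x) (*-inverseʳ (1ℚ + x) {{≢-nonZero h}}) ⟩
  1ℚ * 1ℚ * x
    ≡⟨ *-identityˡ x ⟩
  x ∎
  where
  open ≡-Reasoning
  open ℚ-Solver
  y : ℚ
  y = (1/ (1ℚ + x)) {{≢-nonZero h}}

halves-sum : ∀ q → q * ½ + q * ½ ≡ q
halves-sum = solve 1 (λ q → q :* con ½ :+ q :* con ½ := q) refl
  where open ℚ-Solver

-- The identity holds for n = 0 as well.
mainTheorem13 : (n : ℕ) → 1 ≤ n → (x : ℚ) → (h : 1ℚ + x ≢ 0ℚ) →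
    LHS n x h ≡ RHS n x
mainTheorem13 n _ x h = begin
  LHS n x h                             ≡⟨ peakPolynomial-eulerian (peakWeight-identity x h) (halves-sum (1ℚ + x)) n ⟩
  eulerian x (suc n)                    ≡⟨ eulerian-binomialConvolution x n ⟩
  ((1ℚ - x) ^q_ ⋆ desLrminTerm x) n     ≡⟨ ⋆-comm ((1ℚ - x) ^q_) (desLrminTerm x) n ⟩
  (desLrminTerm x ⋆ (1ℚ - x) ^q_) n     ≡⟨ binomialSum-RHS n x ⟩
  RHS n x                               ∎
  where open ≡-Reasoning
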